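{- Let $D$ be a balanced bipartite digraph with colour classes of cardinalities $a$, where $a\geq 2$. If $\delta(D)\geq (3a+1)/2$, then $D$ contains an oriented cycle of length $2a$.
   Context: A digraph $D$ consists of a finite vertex set $V(D)$ and a set $A(D)$ of ordered pairs of distinct vertices (arcs); no loops or multiple arcs, but both $uv$ and $vu$ may be arcs. For $v\in V(D)$, $d_D(v)=d_D^+(v)+d_D^-(v)$ is the sum of its outdegree and indegree, and $\delta(D)=\min_{v\in V(D)} d_D(v)$. A digraph is bipartite with colour classes $X,Y$ if $V(D)$ is the disjoint union of $X,Y$ and every arc goes between $X$ and $Y$; it is balanced if $|X|=|Y|$. -}

module Defs where

open import Data.Nat using (ℕ; zero; suc; _+_; _*_; _≤_)
open import Data.Bool using (Bool; true; false; T; if_then_else_)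
open import Data.Fin using (Fin; toℕ)
open import Data.List using (List; map; allFin)
open import Data.Nat.ListAction using (sum)
open import Data.Empty using (⊥)
open import Data.Sum using (_⊎_; inj₁; inj₂)
open import Data.Product using (_×_; Σ)
open import Relation.Binary.PropositionalEquality using (_≡_)
open import Function.Definitions using (Injective)

-- A balanced bipartite digraph with colour classes X = Fin a and Y = Fin a.
-- xy x y = true  iff  the arc x→y (from X to Y) is present;
-- yx y x = true  iff  the arc y→x (from Y to X) is present.
-- Every arc goes between X and Y, and there are no loops / multiple arcs.
record BipDigraph (a : ℕ) : Set where
  field
    xy : Fin a → Fin a → Bool
    yx : Fin a → Fin a → Bool
open BipDigraph public

Vtx : ℕ → Set
Vtx a = Fin a ⊎ Fin a

Arc : ∀ {a} → BipDigraph a → Vtx a → Vtx a → Set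
Arc D (inj₁ x) (inj₂ y) = T (xy D x y)
Arc D (inj₂ y) (inj₁ x) = T (yx D y x)
Arc D (inj₁ _) (inj₁ _) = ⊥
Arc D (inj₂ _) (inj₂ _) = ⊥

b2n : Bool → ℕ
b2n true = 1
b2n false = 0

count : ∀ {a} → (Fin a → Bool) → ℕ
count {a} p = sum (map (λ i → b2n (p i)) (allFin a))

outdeg : ∀ {a} → BipDigraph a → Vtx a → ℕ
outdeg D (inj₁ x) = count (λ y → xy D x y)
outdeg D (inj₂ y) = count (λ x → yx D y x)

indeg : ∀ {a} → BipDigraph a → Vtx a → ℕ
indeg D (inj₁ x) = count (λ y → yx D y x)
indeg D (inj₂ y) = count (λ x → xy D x y)

deg : ∀ {a} → BipDigraph a → Vtx a → ℕ
deg D v = outdeg D v + indeg D v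

-- δ(D) ≥ (3a+1)/2, stated without division: 2·d(v) ≥ 3a+1 for every vertex v
MinDegCond : ∀ {a} → BipDigraph a → Set
MinDegCond {a} D = ∀ v → 3 * a + 1 ≤ 2 * deg D v

OrientedCycle : ∀ {a} → BipDigraph a → ℕ → Set
OrientedCycle {a} D n =
  Σ (Fin n → Vtx a) λ c →
    Injective _≡_ _≡_ c ×
    (∀ (i j : Fin n) →
       (suc (toℕ i) ≡ toℕ j ⊎ (suc (toℕ i) ≡ n × toℕ j ≡ 0)) →
       Arc D (c i) (c j) ⊎ Arc D (c j) (c i))

module Submission where

-- An oriented cycle ignores the directions of arcs, so only the underlying
-- bipartite graph G of D matters (x ~ y iff x→y or y→x is an arc).  Since
-- d(v) = d⁺(v) + d⁻(v) counts each G-neighbour of v once or twice, and at most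
-- a of them twice, d(v) ≤ d_G(v) + a; hence 2·d_G(v) ≥ a + 1, i.e. G is a
-- balanced bipartite graph of minimum degree > a/2.  Such a graph has a
-- Hamiltonian cycle (Moon–Moser), which we construct by a rotation argument.
-- Start from a cyclic ordering of all vertices alternating between the classes.
-- While some consecutive pair is non-adjacent, rotate it to the closing position
-- t, s.  By pigeonhole some step u, w of the path s … t has s ~ w and t ~ u, and
-- reversing the segment w … t keeps the ordering alternating while strictly
-- decreasing the number of non-adjacent consecutive pairs.

open import Defs
open import Data.Bool using (Bool; true; false; T; not; _∧_; _∨_)
open import Data.Bool.Properties using (T-∧; T-∨; T-≡)
open import Data.Empty using (⊥-elim)
open import Data.Fin using (Fin; toℕ; zero; suc)
open import Data.Fin.Properties using (toℕ-injective; toℕ<n)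
open import Data.List using (List; []; _∷_; _++_; map; length; allFin; tabulate)
open import Data.List.Membership.Propositional using (_∈_)
open import Data.List.Membership.Propositional.Properties using (∈-map⁻)
open import Data.List.Properties using (++-assoc; map-++; map-∘; length-map; length-++; length-tabulate)
open import Data.List.Relation.Binary.Permutation.Propositional using (_↭_; ↭-refl; ↭-prep; ↭-trans; ↭-sym; ↭⇒↭ₛ)
open import Data.List.Relation.Binary.Permutation.Propositional.Properties
  using (++-comm; shift; ++⁺ˡ; ↭-length) renaming (map⁺ to ↭-map⁺)
import Data.List.Relation.Binary.Permutation.Setoid.Properties as SetoidPermutation
open import Data.List.Relation.Unary.All as All using (All; []; _∷_)
open import Data.List.Relation.Unary.Any using (here; there)
open import Data.List.Relation.Unary.Unique.Propositional using (Unique; _∷_)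
open import Data.List.Relation.Unary.Unique.Propositional.Properties
  using (++⁺; allFin⁺) renaming (map⁺ to unique-map⁺)
open import Data.Nat using (ℕ; zero; suc; _+_; _*_; _≤_; _<_; z≤n; s≤s; _≟_)
open import Data.Nat.Induction using (<-wellFounded)
open import Data.Nat.ListAction using (sum)
open import Data.Nat.ListAction.Properties using (sum-++; sum-↭)
open import Data.Nat.Properties
open import Algebra.Properties.CommutativeSemigroup +-commutativeSemigroup using (interchange)
open import Data.Nat.Solver using (module +-*-Solver)
open import Data.Product using (_×_; _,_; proj₁; proj₂; Σ; ∃-syntax)
open import Data.Sum using (_⊎_; inj₁; inj₂; swap)
open import Data.Sum.Properties using (inj₁-injective; inj₂-injective)
open import Data.Unit using (tt)
open import Function.Bundles using (Equivalence)
open import Function.Definitions using (Injective)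
open import Induction.WellFounded using (Acc; acc)
open import Relation.Binary.PropositionalEquality
open import Relation.Nullary using (¬_; yes; no)

b2n-mono : ∀ {b c} → (T b → T c) → b2n b ≤ b2n c
b2n-mono {false} _ = z≤n
b2n-mono {true} {true} _ = ≤-refl
b2n-mono {true} {false} b⇒c = ⊥-elim (b⇒c tt)

b2n-∨-∧ : ∀ b c → b2n b + b2n c ≡ b2n (b ∨ c) + b2n (b ∧ c)
b2n-∨-∧ false c = sym (+-identityʳ (b2n c))
b2n-∨-∧ true false = refl
b2n-∨-∧ true true = refl

b2n≡0 : ∀ {b} → b2n b ≡ 0 → b ≡ false
b2n≡0 {false} _ = refl

not≡false : ∀ {b} → not b ≡ false → T b
not≡false {true} _ = tt

T⇒not≡false : ∀ {b} → T b → not b ≡ false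
T⇒not≡false {true} _ = refl

module _ {A : Set} where

  -- On allFin a this is literally the function `count` of Defs.
  cnt : (A → Bool) → List A → ℕ
  cnt p l = sum (map (λ x → b2n (p x)) l)

  cnt-++ : ∀ p l₁ l₂ → cnt p (l₁ ++ l₂) ≡ cnt p l₁ + cnt p l₂
  cnt-++ p l₁ l₂ = trans (cong sum (map-++ _ l₁ l₂)) (sum-++ (map _ l₁) _)

  cnt-↭ : ∀ p {l l′} → l ↭ l′ → cnt p l ≡ cnt p l′
  cnt-↭ p l↭l′ = sum-↭ (↭-map⁺ _ l↭l′)

  cnt-mono : ∀ {p q} → (∀ x → T (p x) → T (q x)) → ∀ l → cnt p l ≤ cnt q l
  cnt-mono p⇒q [] = z≤n
  cnt-mono p⇒q (x ∷ l) = +-mono-≤ (b2n-mono (p⇒q x)) (cnt-mono p⇒q l)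

  cnt-true : ∀ l → cnt (λ _ → true) l ≡ length l
  cnt-true [] = refl
  cnt-true (x ∷ l) = cong suc (cnt-true l)

  cnt-false : ∀ l → cnt (λ _ → false) l ≡ 0
  cnt-false [] = refl
  cnt-false (x ∷ l) = cnt-false l

  cnt-≤-length : ∀ p l → cnt p l ≤ length l
  cnt-≤-length p l = subst (cnt p l ≤_) (cnt-true l) (cnt-mono (λ _ _ → tt) l)

  cnt-∨-∧ : ∀ p q l → cnt p l + cnt q l ≡ cnt (λ x → p x ∨ q x) l + cnt (λ x → p x ∧ q x) l
  cnt-∨-∧ p q [] = refl
  cnt-∨-∧ p q (x ∷ l) =
    trans (interchange (b2n (p x)) (cnt p l) (b2n (q x)) (cnt q l))
      (trans (cong₂ _+_ (b2n-∨-∧ (p x) (q x)) (cnt-∨-∧ p q l))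
        (interchange (b2n (p x ∨ q x)) (b2n (p x ∧ q x)) _ _))

  cnt-∨-≤ : ∀ p q l → cnt (λ x → p x ∨ q x) l ≤ cnt p l + cnt q l
  cnt-∨-≤ p q l = subst (cnt (λ x → p x ∨ q x) l ≤_) (sym (cnt-∨-∧ p q l)) (m≤m+n _ _)

  cnt-+-≤ : ∀ p q l → cnt p l + cnt q l ≤ cnt (λ x → p x ∨ q x) l + length l
  cnt-+-≤ p q l = subst (_≤ cnt (λ x → p x ∨ q x) l + length l) (sym (cnt-∨-∧ p q l))
    (+-monoʳ-≤ (cnt (λ x → p x ∨ q x) l) (cnt-≤-length (λ x → p x ∧ q x) l))

  none-fail : ∀ (p : A → Bool) l → cnt (λ x → not (p x)) l ≡ 0 → All (λ x → T (p x)) l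
  none-fail p [] _ = []
  none-fail p (x ∷ l) none =
    not≡false (b2n≡0 (m+n≡0⇒m≡0 _ none)) ∷ none-fail p l (m+n≡0⇒n≡0 _ none)

cnt-map : ∀ {A B : Set} (p : A → Bool) (f : B → A) l → cnt p (map f l) ≡ cnt (λ x → p (f x)) l
cnt-map p f l = cong sum (sym (map-∘ l))

-- Paths and cyclic orderings given by lists

exchange : ∀ x y a b c d → (x + a) + (y + b) + (c + d) ≡ (x + c) + (y + d) + (a + b)
exchange = solve 6 (λ x y a b c d → ((x :+ a) :+ (y :+ b)) :+ (c :+ d) := ((x :+ c) :+ (y :+ d)) :+ (a :+ b)) refl
  where open +-*-Solver

module _ {A : Set} where

  -- A path is a first vertex x followed by a list l of vertices; steps x l
  -- lists its consecutive pairs and end x l is its last vertex.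
  steps : A → List A → List (A × A)
  steps x [] = []
  steps x (y ∷ l) = (x , y) ∷ steps y l

  end : A → List A → A
  end x [] = x
  end x (y ∷ l) = end y l

  -- end x l ∷ back x l is the path x ∷ l traversed backwards.
  back : A → List A → List A
  back x [] = []
  back x (y ∷ l) = back y l ++ x ∷ []

  -- The steps of the path x, l …, y.  In particular arc s r s lists the
  -- cyclically consecutive pairs of the cyclic ordering s ∷ r.
  arc : A → List A → A → List (A × A)
  arc x l y = steps x (l ++ y ∷ [])

  SymmetricTest : (A × A → Bool) → Set
  SymmetricTest p = ∀ u w → p (u , w) ≡ p (w , u)

  steps-++ : ∀ x l₁ l₂ → steps x (l₁ ++ l₂) ≡ steps x l₁ ++ steps (end x l₁) l₂
  steps-++ x [] l₂ = refl
  steps-++ x (y ∷ l₁) l₂ = cong ((x , y) ∷_) (steps-++ y l₁ l₂)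

  end-++ : ∀ x l₁ l₂ → end x (l₁ ++ l₂) ≡ end (end x l₁) l₂
  end-++ x [] l₂ = refl
  end-++ x (y ∷ l₁) l₂ = end-++ y l₁ l₂

  end-back : ∀ x l → end (end x l) (back x l) ≡ x
  end-back x [] = refl
  end-back x (y ∷ l) = end-++ (end y l) (back y l) (x ∷ [])

  back-↭ : ∀ x l → (x ∷ l) ↭ (end x l ∷ back x l)
  back-↭ x [] = ↭-refl
  back-↭ x (y ∷ l) = ↭-trans (↭-prep x (back-↭ y l)) (++-comm (x ∷ []) (end y l ∷ back y l))

  cnt-arc : ∀ p x l y → cnt p (arc x l y) ≡ cnt p (steps x l) + b2n (p (end x l , y))
  cnt-arc p x l y = begin
    cnt p (steps x (l ++ y ∷ []))                            ≡⟨ cong (cnt p) (steps-++ x l (y ∷ [])) ⟩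
    cnt p (steps x l ++ (end x l , y) ∷ [])                   ≡⟨ cnt-++ p (steps x l) _ ⟩
    cnt p (steps x l) + (b2n (p (end x l , y)) + 0)          ≡⟨ cong (cnt p (steps x l) +_) (+-identityʳ _) ⟩
    cnt p (steps x l) + b2n (p (end x l , y))                ∎
    where open ≡-Reasoning

  arc-none : ∀ p x l y → cnt p (arc x l y) ≡ 0 → cnt p (steps x l) ≡ 0 × p (end x l , y) ≡ false
  arc-none p x l y none =
    let none′ = trans (sym (cnt-arc p x l y)) none
    in m+n≡0⇒m≡0 _ none′ , b2n≡0 (m+n≡0⇒n≡0 (cnt p (steps x l)) none′)

  arc-inner : ∀ p x l y → p (end x l , y) ≡ false → cnt p (arc x l y) ≡ cnt p (steps x l)
  arc-inner p x l y fails =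
    trans (cnt-arc p x l y) (trans (cong (λ b → cnt p (steps x l) + b2n b) fails) (+-identityʳ _))

  cnt-arc-split : ∀ p x l₁ w l₂ y → cnt p (arc x (l₁ ++ w ∷ l₂) y) ≡ cnt p (arc x l₁ w) + cnt p (arc w l₂ y)
  cnt-arc-split p x l₁ w l₂ y = begin
    cnt p (steps x ((l₁ ++ w ∷ l₂) ++ y ∷ []))            ≡⟨ cong (λ l → cnt p (steps x l)) (++-assoc l₁ (w ∷ l₂) (y ∷ [])) ⟩
    cnt p (steps x (l₁ ++ w ∷ l₂ ++ y ∷ []))              ≡⟨ cong (cnt p) (steps-++ x l₁ _) ⟩
    cnt p (steps x l₁ ++ (end x l₁ , w) ∷ arc w l₂ y)     ≡⟨ cnt-++ p (steps x l₁) _ ⟩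
    cnt p (steps x l₁) + (b2n (p (end x l₁ , w)) + cnt p (arc w l₂ y)) ≡⟨ sym (+-assoc (cnt p (steps x l₁)) _ _) ⟩
    (cnt p (steps x l₁) + b2n (p (end x l₁ , w))) + cnt p (arc w l₂ y) ≡⟨ cong (_+ cnt p (arc w l₂ y)) (sym (cnt-arc p x l₁ w)) ⟩
    cnt p (arc x l₁ w) + cnt p (arc w l₂ y)               ∎
    where open ≡-Reasoning

  cnt-rotate : ∀ p s l₁ w l₂ → cnt p (arc s (l₁ ++ w ∷ l₂) s) ≡ cnt p (arc w (l₂ ++ s ∷ l₁) w)
  cnt-rotate p s l₁ w l₂ =
    trans (cnt-arc-split p s l₁ w l₂ s)
      (trans (+-comm (cnt p (arc s l₁ w)) _) (sym (cnt-arc-split p w l₂ s l₁ w)))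

  cnt-steps-back : ∀ p → SymmetricTest p → ∀ x l → cnt p (steps (end x l) (back x l)) ≡ cnt p (steps x l)
  cnt-steps-back p sym-p x [] = refl
  cnt-steps-back p sym-p x (y ∷ l) = begin
    cnt p (arc (end y l) (back y l) x)                                      ≡⟨ cnt-arc p _ (back y l) x ⟩
    cnt p (steps (end y l) (back y l)) + b2n (p (end (end y l) (back y l) , x))
      ≡⟨ cong₂ (λ c v → c + b2n (p (v , x))) (cnt-steps-back p sym-p y l) (end-back y l) ⟩
    cnt p (steps y l) + b2n (p (y , x))                                     ≡⟨ +-comm (cnt p (steps y l)) _ ⟩
    b2n (p (y , x)) + cnt p (steps y l)                                     ≡⟨ cong (λ b → b2n b + cnt p (steps y l)) (sym-p y x) ⟩
    b2n (p (x , y)) + cnt p (steps y l)                                     ∎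
    where open ≡-Reasoning

  -- Reversing the segment w … t of the cyclic ordering s, l₁ …, u, w, l₂ …, t
  -- replaces the consecutive pairs (u , w) and (t , s) by (u , t) and (w , s).
  cnt-reverse-segment : ∀ p → SymmetricTest p → ∀ s l₁ w l₂ →
    cnt p (arc s (l₁ ++ end w l₂ ∷ back w l₂) s)
      + (b2n (p (end s l₁ , w)) + b2n (p (end w l₂ , s)))
    ≡ cnt p (arc s (l₁ ++ w ∷ l₂) s)
      + (b2n (p (end s l₁ , end w l₂)) + b2n (p (w , s)))
  cnt-reverse-segment p sym-p s l₁ w l₂ = begin
    cnt p (arc s (l₁ ++ t ∷ back w l₂) s) + (uw + ts)
      ≡⟨ cong (_+ (uw + ts)) (cnt-arc-split p s l₁ t (back w l₂) s) ⟩
    (cnt p (arc s l₁ t) + cnt p (arc t (back w l₂) s)) + (uw + ts)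
      ≡⟨ cong₂ (λ c c′ → (c + c′) + (uw + ts)) (cnt-arc p s l₁ t) backward ⟩
    ((X + ut) + (Y + ws)) + (uw + ts)
      ≡⟨ exchange X Y ut ws uw ts ⟩
    ((X + uw) + (Y + ts)) + (ut + ws)
      ≡⟨ cong₂ (λ c c′ → (c + c′) + (ut + ws)) (sym (cnt-arc p s l₁ w)) (sym (cnt-arc p w l₂ s)) ⟩
    (cnt p (arc s l₁ w) + cnt p (arc w l₂ s)) + (ut + ws)
      ≡⟨ cong (_+ (ut + ws)) (sym (cnt-arc-split p s l₁ w l₂ s)) ⟩
    cnt p (arc s (l₁ ++ w ∷ l₂) s) + (ut + ws) ∎
    where
      open ≡-Reasoning
      u = end s l₁
      t = end w l₂
      X = cnt p (steps s l₁)
      Y = cnt p (steps w l₂)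
      uw = b2n (p (u , w))
      ts = b2n (p (t , s))
      ut = b2n (p (u , t))
      ws = b2n (p (w , s))
      backward : cnt p (arc t (back w l₂) s) ≡ Y + ws
      backward = trans (cnt-arc p t (back w l₂) s)
        (cong₂ (λ c v → c + b2n (p (v , s))) (cnt-steps-back p sym-p w l₂) (end-back w l₂))

  reverse-segment-≤ : ∀ p → SymmetricTest p → ∀ s l₁ w l₂ →
    p (end s l₁ , end w l₂) ≡ false → p (w , s) ≡ false →
    cnt p (arc s (l₁ ++ end w l₂ ∷ back w l₂) s) + b2n (p (end w l₂ , s)) ≤ cnt p (arc s (l₁ ++ w ∷ l₂) s)
  reverse-segment-≤ p sym-p s l₁ w l₂ ut-fails ws-fails = begin
    new + ts              ≤⟨ +-monoʳ-≤ new (m≤n+m ts uw) ⟩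
    new + (uw + ts)       ≡⟨ cnt-reverse-segment p sym-p s l₁ w l₂ ⟩
    old + (b2n (p (end s l₁ , end w l₂)) + b2n (p (w , s)))
                          ≡⟨ cong₂ (λ b c → old + (b2n b + b2n c)) ut-fails ws-fails ⟩
    old + 0               ≡⟨ +-identityʳ old ⟩
    old                   ∎
    where
      open ≤-Reasoning
      new = cnt p (arc s (l₁ ++ end w l₂ ∷ back w l₂) s)
      old = cnt p (arc s (l₁ ++ w ∷ l₂) s)
      uw = b2n (p (end s l₁ , w))
      ts = b2n (p (end w l₂ , s))

  cnt-steps-snd : ∀ (g : A → Bool) x l → cnt (λ z → g (proj₂ z)) (steps x l) ≡ cnt g l
  cnt-steps-snd g x [] = refl
  cnt-steps-snd g x (y ∷ l) = cong (b2n (g y) +_) (cnt-steps-snd g y l)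

  cnt-steps-fst : ∀ (g : A → Bool) x l → cnt (λ z → g (proj₁ z)) (steps x l) + b2n (g (end x l)) ≡ cnt g (x ∷ l)
  cnt-steps-fst g x [] = sym (+-identityʳ (b2n (g x)))
  cnt-steps-fst g x (y ∷ l) = trans (+-assoc (b2n (g x)) _ _) (cong (b2n (g x) +_) (cnt-steps-fst g y l))

  split-at-step : ∀ p x l → 0 < cnt p (steps x l) →
    ∃[ l₁ ] ∃[ w ] ∃[ l₂ ] (l ≡ l₁ ++ w ∷ l₂ × T (p (end x l₁ , w)))
  split-at-step p x (y ∷ l) some with p (x , y) in passes
  ... | true = [] , y , l , refl , subst T (sym passes) tt
  ... | false with split-at-step p y l some
  ...   | l₁ , w , l₂ , refl , w-passes = y ∷ l₁ , w , l₂ , refl , w-passes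

  at : A → List A → ℕ → A
  at x l zero = x
  at x [] (suc k) = x
  at x (y ∷ l) (suc k) = at y l k

  at-end : ∀ x l → at x l (length l) ≡ end x l
  at-end x [] = refl
  at-end x (y ∷ l) = at-end y l

  at-∈ : ∀ x l k → k < length l → at x l (suc k) ∈ l
  at-∈ x (y ∷ l) zero _ = here refl
  at-∈ x (y ∷ l) (suc k) (s≤s k<l) = there (at-∈ y l k k<l)

  at-injective : ∀ x l → Unique (x ∷ l) → ∀ i j → i ≤ length l → j ≤ length l → at x l i ≡ at x l j → i ≡ j
  at-injective x l u zero zero _ _ _ = refl
  at-injective x l (x∉l ∷ _) zero (suc j) _ j<l eq = ⊥-elim (All.lookup x∉l (at-∈ x l j j<l) eq)
  at-injective x l (x∉l ∷ _) (suc i) zero i<l _ eq = ⊥-elim (All.lookup x∉l (at-∈ x l i i<l) (sym eq))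
  at-injective x (y ∷ l) (_ ∷ u) (suc i) (suc j) (s≤s i≤l) (s≤s j≤l) eq = cong suc (at-injective y l u i j i≤l j≤l eq)

  at-step : ∀ (p : A × A → Bool) x l → All (λ z → T (p z)) (steps x l) →
    ∀ k → k < length l → T (p (at x l k , at x l (suc k)))
  at-step p x (y ∷ l) (xy ∷ _) zero _ = xy
  at-step p x (y ∷ l) (_ ∷ rest) (suc k) (s≤s k<l) = at-step p y l rest k k<l

-- n distinct elements c₀ … c_{n-1} of A with R between cyclically consecutive
-- ones; OrientedCycle D n is the case R u w = Arc D u w ⊎ Arc D w u.
CyclicArrangement : {A : Set} → (A → A → Set) → ℕ → Set
CyclicArrangement {A} R n =
  Σ (Fin n → A) λ c →
    Injective _≡_ _≡_ c ×
    (∀ (i j : Fin n) → (suc (toℕ i) ≡ toℕ j ⊎ (suc (toℕ i) ≡ n × toℕ j ≡ 0)) → R (c i) (c j))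

arrangement-map : ∀ {A : Set} {R S : A → A → Set} {n} →
  (∀ u w → R u w → S u w) → CyclicArrangement R n → CyclicArrangement S n
arrangement-map R⇒S (c , c-injective , related) = c , c-injective , λ i j next → R⇒S (c i) (c j) (related i j next)

ordering⇒arrangement : ∀ {A : Set} (p : A × A → Bool) s r {n} → suc (length r) ≡ n → Unique (s ∷ r) →
  All (λ z → T (p z)) (steps s r) → T (p (end s r , s)) → CyclicArrangement (λ u w → T (p (u , w))) n
ordering⇒arrangement p s r {n} length≡n distinct pass closing = c , c-injective , related
  where
    c : Fin n → _
    c i = at s r (toℕ i)
    in-range : ∀ (i : Fin n) → toℕ i ≤ length r
    in-range i = ≤-pred (subst (toℕ i <_) (sym length≡n) (toℕ<n i))
    c-injective : Injective _≡_ _≡_ c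
    c-injective {i} {j} eq = toℕ-injective (at-injective s r distinct (toℕ i) (toℕ j) (in-range i) (in-range j) eq)
    related : ∀ i j → (suc (toℕ i) ≡ toℕ j ⊎ (suc (toℕ i) ≡ n × toℕ j ≡ 0)) → T (p (c i , c j))
    related i j (inj₁ next) =
      subst (λ k → T (p (c i , at s r k))) next
        (at-step p s r pass (toℕ i) (subst (_≤ length r) (sym next) (in-range j)))
    related i j (inj₂ (last , first)) =
      subst₂ (λ k k′ → T (p (at s r k , at s r k′))) (sym i≡last) (sym first)
        (subst (λ v → T (p (v , s))) (sym (at-end s r)) closing)
      where
        i≡last : toℕ i ≡ length r
        i≡last = suc-injective (trans last (sym length≡n))

allFin-nonempty : ∀ {n} → 0 < n → ∃[ x ] ∃[ L ] allFin n ≡ x ∷ L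
allFin-nonempty {suc n} _ = zero , tabulate suc , refl

-- Arithmetic for the pigeonhole step: two sets of sizes > a/2 in a set of size a meet.
pigeonhole : ∀ {a m n u i} → a + 1 ≤ 2 * m → a + 1 ≤ 2 * n → m + n ≡ u + i → u ≤ a → 0 < i
pigeonhole {a} {m} {n} {u} {i} m-large n-large m+n≡u+i u≤a = +-cancelˡ-≤ a 1 i (begin
    a + 1     ≤⟨ *-cancelˡ-≤ 2 twice ⟩
    m + n     ≡⟨ m+n≡u+i ⟩
    u + i     ≤⟨ +-monoˡ-≤ i u≤a ⟩
    a + i     ∎)
  where
    open ≤-Reasoning
    twice : 2 * (a + 1) ≤ 2 * (m + n)
    twice = subst₂ _≤_ (cong ((a + 1) +_) (sym (+-identityʳ (a + 1)))) (sym (*-distribˡ-+ 2 m n))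
              (+-mono-≤ m-large n-large)

-- Dense balanced bipartite graphs are Hamiltonian

module Bipartite {a : ℕ} (B : Fin a → Fin a → Bool) where

  V : Set
  V = Vtx a

  adj : V → V → Bool
  adj (inj₁ x) (inj₁ _) = false
  adj (inj₁ x) (inj₂ y) = B x y
  adj (inj₂ y) (inj₁ x) = B x y
  adj (inj₂ _) (inj₂ _) = false

  adjacent : V × V → Bool
  adjacent (u , w) = adj u w

  gap : V × V → Bool
  gap z = not (adjacent z)

  sameSide : V × V → Bool
  sameSide (inj₁ _ , inj₁ _) = true
  sameSide (inj₁ _ , inj₂ _) = false
  sameSide (inj₂ _ , inj₁ _) = false
  sameSide (inj₂ _ , inj₂ _) = true

  adj-irreflexive : ∀ v → adj v v ≡ false
  adj-irreflexive (inj₁ x) = refl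
  adj-irreflexive (inj₂ y) = refl

  adjacent-symmetric : SymmetricTest adjacent
  adjacent-symmetric (inj₁ x) (inj₁ y) = refl
  adjacent-symmetric (inj₁ x) (inj₂ y) = refl
  adjacent-symmetric (inj₂ y) (inj₁ x) = refl
  adjacent-symmetric (inj₂ x) (inj₂ y) = refl

  gap-symmetric : SymmetricTest gap
  gap-symmetric u w = cong not (adjacent-symmetric u w)

  sameSide-symmetric : SymmetricTest sameSide
  sameSide-symmetric (inj₁ x) (inj₁ y) = refl
  sameSide-symmetric (inj₁ x) (inj₂ y) = refl
  sameSide-symmetric (inj₂ y) (inj₁ x) = refl
  sameSide-symmetric (inj₂ x) (inj₂ y) = refl

  adj⇒sides : ∀ u w → T (adj u w) → sameSide (u , w) ≡ false
  adj⇒sides (inj₁ x) (inj₂ y) _ = refl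
  adj⇒sides (inj₂ y) (inj₁ x) _ = refl

  neighbour-sides : ∀ s t u w → sameSide (s , t) ≡ false → T (adj s w ∨ adj t u) →
    T (sameSide (s , u) ∨ sameSide (u , w))
  neighbour-sides (inj₁ _) (inj₂ _) (inj₁ _) w _ _ = tt
  neighbour-sides (inj₁ _) (inj₂ _) (inj₂ _) (inj₂ _) _ _ = tt
  neighbour-sides (inj₂ _) (inj₁ _) (inj₂ _) w _ _ = tt
  neighbour-sides (inj₂ _) (inj₁ _) (inj₁ _) (inj₁ _) _ _ = tt

  vertices : List V
  vertices = map inj₁ (allFin a) ++ map inj₂ (allFin a)

  vertices-unique : Unique vertices
  vertices-unique = ++⁺ (unique-map⁺ inj₁-injective (allFin⁺ a)) (unique-map⁺ inj₂-injective (allFin⁺ a)) disjoint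
    where
      disjoint : ∀ {v} → ¬ (v ∈ map inj₁ (allFin a) × v ∈ map inj₂ (allFin a))
      disjoint (in₁ , in₂) with ∈-map⁻ inj₁ in₁ | ∈-map⁻ inj₂ in₂
      ... | x , _ , refl | y , _ , ()

  length-vertices : length vertices ≡ 2 * a
  length-vertices = begin
    length vertices                                            ≡⟨ length-++ (map inj₁ (allFin a)) ⟩
    length (map inj₁ (allFin a)) + length (map inj₂ (allFin a)) ≡⟨ cong₂ _+_ (length-map inj₁ (allFin a)) (length-map inj₂ (allFin a)) ⟩
    length (allFin a) + length (allFin a)                       ≡⟨ cong₂ _+_ length-allFin (trans length-allFin (sym (+-identityʳ a))) ⟩
    2 * a                                                       ∎
    where
      open ≡-Reasoning
      length-allFin : length (allFin a) ≡ a
      length-allFin = length-tabulate (λ i → i)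

  cnt-vertices : ∀ g → cnt g vertices ≡ cnt (λ x → g (inj₁ x)) (allFin a) + cnt (λ y → g (inj₂ y)) (allFin a)
  cnt-vertices g = trans (cnt-++ g (map inj₁ (allFin a)) _) (cong₂ _+_ (cnt-map g inj₁ (allFin a)) (cnt-map g inj₂ (allFin a)))

  side-size : ∀ s → cnt (λ u → sameSide (s , u)) vertices ≡ a
  side-size (inj₁ x) = begin
    cnt (λ u → sameSide (inj₁ x , u)) vertices       ≡⟨ cnt-vertices _ ⟩
    cnt (λ _ → true) (allFin a) + cnt (λ _ → false) (allFin a) ≡⟨ cong₂ _+_ (cnt-true (allFin a)) (cnt-false (allFin a)) ⟩
    length (allFin a) + 0                            ≡⟨ trans (+-identityʳ _) (length-tabulate (λ i → i)) ⟩
    a                                                ∎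
    where open ≡-Reasoning
  side-size (inj₂ y) = begin
    cnt (λ u → sameSide (inj₂ y , u)) vertices       ≡⟨ cnt-vertices _ ⟩
    cnt (λ _ → false) (allFin a) + cnt (λ _ → true) (allFin a) ≡⟨ cong₂ _+_ (cnt-false (allFin a)) (cnt-true (allFin a)) ⟩
    length (allFin a)                                ≡⟨ length-tabulate (λ i → i) ⟩
    a                                                ∎
    where open ≡-Reasoning

  degree : V → ℕ
  degree v = cnt (adj v) vertices

  degree-X : ∀ x → degree (inj₁ x) ≡ cnt (B x) (allFin a)
  degree-X x = trans (cnt-vertices (adj (inj₁ x))) (cong (_+ cnt (B x) (allFin a)) (cnt-false (allFin a)))

  degree-Y : ∀ y → degree (inj₂ y) ≡ cnt (λ x → B x y) (allFin a)
  degree-Y y = trans (cnt-vertices (adj (inj₂ y)))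
    (trans (cong (cnt (λ x → B x y) (allFin a) +_) (cnt-false (allFin a))) (+-identityʳ _))

  Dense : Set
  Dense = ∀ v → a + 1 ≤ 2 * degree v

  record IsTour (s : V) (r : List V) : Set where
    field
      spanning    : (s ∷ r) ↭ vertices
      alternating : cnt sameSide (arc s r s) ≡ 0
  open IsTour

  gaps : V → List V → ℕ
  gaps s r = cnt gap (arc s r s)

  cnt-tour : ∀ {s r} → IsTour s r → ∀ g → cnt g (s ∷ r) ≡ cnt g vertices
  cnt-tour τ g = cnt-↭ g (spanning τ)

  tour-unique : ∀ {s r} → IsTour s r → Unique (s ∷ r)
  tour-unique τ = SetoidPermutation.Unique-resp-↭ (setoid V) (↭⇒↭ₛ (↭-sym (spanning τ))) vertices-unique

  tour-length : ∀ {s r} → IsTour s r → suc (length r) ≡ 2 * a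
  tour-length τ = trans (↭-length (spanning τ)) length-vertices

  cnt-second-vertices : ∀ {s r} → IsTour s r → ∀ g → g s ≡ false →
    cnt (λ z → g (proj₂ z)) (steps s r) ≡ cnt g vertices
  cnt-second-vertices {s} {r} τ g g-s = begin
    cnt (λ z → g (proj₂ z)) (steps s r)   ≡⟨ cnt-steps-snd g s r ⟩
    cnt g r                               ≡⟨ cong (λ b → b2n b + cnt g r) (sym g-s) ⟩
    cnt g (s ∷ r)                         ≡⟨ cnt-tour τ g ⟩
    cnt g vertices                        ∎
    where open ≡-Reasoning

  cnt-first-vertices : ∀ {s r} → IsTour s r → ∀ g → g (end s r) ≡ false →
    cnt (λ z → g (proj₁ z)) (steps s r) ≡ cnt g vertices
  cnt-first-vertices {s} {r} τ g g-t = begin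
    cnt firsts (steps s r)                         ≡⟨ sym (+-identityʳ _) ⟩
    cnt firsts (steps s r) + 0                     ≡⟨ cong (λ b → cnt firsts (steps s r) + b2n b) (sym g-t) ⟩
    cnt firsts (steps s r) + b2n (g (end s r))     ≡⟨ cnt-steps-fst g s r ⟩
    cnt g (s ∷ r)                                  ≡⟨ cnt-tour τ g ⟩
    cnt g vertices                                 ∎
    where
      open ≡-Reasoning
      firsts : V × V → Bool
      firsts z = g (proj₁ z)

  rotate : ∀ {s} l₁ w l₂ → IsTour s (l₁ ++ w ∷ l₂) → IsTour w (l₂ ++ s ∷ l₁)
  rotate {s} l₁ w l₂ τ = record
    { spanning    = ↭-trans (++-comm (w ∷ l₂) (s ∷ l₁)) (spanning τ)
    ; alternating = trans (sym (cnt-rotate sameSide s l₁ w l₂)) (alternating τ)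
    }

  gap-at-closing : ∀ {s r} → IsTour s r → 0 < gaps s r →
    ∃[ s′ ] ∃[ r′ ] (IsTour s′ r′ × gaps s′ r′ ≡ gaps s r × T (gap (end s′ r′ , s′)))
  gap-at-closing {s} {r} τ some with gap (end s r , s) in closing
  ... | true = s , r , τ , refl , subst T (sym closing) tt
  ... | false with split-at-step gap s r (subst (0 <_) (arc-inner gap s r s closing) some)
  ...   | l₁ , w , l₂ , refl , uw-gap =
          w , l₂ ++ s ∷ l₁ , rotate l₁ w l₂ τ , sym (cnt-rotate gap s l₁ w l₂) ,
          subst (λ v → T (gap (v , w))) (sym (end-++ w l₂ (s ∷ l₁))) uw-gap

  -- Pigeonhole: in a tour s ∷ r of a dense graph, with t = end s r, some step
  -- (u , w) of the path s … t has s ~ w and t ~ u.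
  crossing-step : Dense → ∀ {s r} → IsTour s r →
    0 < cnt (λ z → adj s (proj₂ z) ∧ adj (end s r) (proj₁ z)) (steps s r)
  crossing-step dense {s} {r} τ =
    pigeonhole {m = degree s} {n = degree t} (dense s) (dense t)
      (trans (sym (cong₂ _+_ to-s to-t)) (cnt-∨-∧ toS toT (steps s r))) either-≤
    where
      t = end s r
      toS toT : V × V → Bool
      toS z = adj s (proj₂ z)
      toT z = adj t (proj₁ z)
      alternation : cnt sameSide (steps s r) ≡ 0 × sameSide (t , s) ≡ false
      alternation = arc-none sameSide s r s (alternating τ)
      s-t-apart : sameSide (s , t) ≡ false
      s-t-apart = trans (sameSide-symmetric s t) (proj₂ alternation)
      to-s : cnt toS (steps s r) ≡ degree s
      to-s = cnt-second-vertices τ (adj s) (adj-irreflexive s)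
      to-t : cnt toT (steps s r) ≡ degree t
      to-t = cnt-first-vertices τ (adj t) (adj-irreflexive t)
      on-side-of-s : cnt (λ z → sameSide (s , proj₁ z)) (steps s r) ≡ a
      on-side-of-s = trans (cnt-first-vertices τ (λ u → sameSide (s , u)) s-t-apart) (side-size s)
      -- a step (u , w) passing either test has u on the side of s or on the side of w
      either-≤ : cnt (λ z → toS z ∨ toT z) (steps s r) ≤ a
      either-≤ = begin
        cnt (λ z → toS z ∨ toT z) (steps s r)
          ≤⟨ cnt-mono (λ z → neighbour-sides s t (proj₁ z) (proj₂ z) s-t-apart) (steps s r) ⟩
        cnt (λ z → sameSide (s , proj₁ z) ∨ sameSide z) (steps s r)
          ≤⟨ cnt-∨-≤ (λ z → sameSide (s , proj₁ z)) sameSide (steps s r) ⟩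
        cnt (λ z → sameSide (s , proj₁ z)) (steps s r) + cnt sameSide (steps s r)
          ≡⟨ cong₂ _+_ on-side-of-s (proj₁ alternation) ⟩
        a + 0
          ≡⟨ +-identityʳ a ⟩
        a ∎
        where open ≤-Reasoning

  reverse-segment : ∀ s l₁ w l₂ → IsTour s (l₁ ++ w ∷ l₂) →
    T (gap (end w l₂ , s)) → T (adj s w) → T (adj (end w l₂) (end s l₁)) →
    IsTour s (l₁ ++ end w l₂ ∷ back w l₂) × gaps s (l₁ ++ end w l₂ ∷ back w l₂) < gaps s (l₁ ++ w ∷ l₂)
  reverse-segment s l₁ w l₂ τ ts-gap s~w t~u = reversed , fewer
    where
      u = end s l₁
      t = end w l₂
      u~t : T (adj u t)
      u~t = subst T (adjacent-symmetric t u) t~u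
      w~s : T (adj w s)
      w~s = subst T (adjacent-symmetric s w) s~w
      alternation-≤ : cnt sameSide (arc s (l₁ ++ t ∷ back w l₂) s) + b2n (sameSide (t , s)) ≤ 0
      alternation-≤ = subst (cnt sameSide (arc s (l₁ ++ t ∷ back w l₂) s) + b2n (sameSide (t , s)) ≤_) (alternating τ)
        (reverse-segment-≤ sameSide sameSide-symmetric s l₁ w l₂ (adj⇒sides u t u~t) (adj⇒sides w s w~s))
      reversed : IsTour s (l₁ ++ t ∷ back w l₂)
      reversed = record
        { spanning    = ↭-trans (↭-prep s (++⁺ˡ l₁ (↭-sym (back-↭ w l₂)))) (spanning τ)
        ; alternating = n≤0⇒n≡0 (≤-trans (m≤m+n _ _) alternation-≤)
        }
      new old : ℕ
      new = gaps s (l₁ ++ t ∷ back w l₂)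
      old = gaps s (l₁ ++ w ∷ l₂)
      drop : new + b2n (gap (t , s)) ≤ old
      drop = reverse-segment-≤ gap gap-symmetric s l₁ w l₂ (T⇒not≡false u~t) (T⇒not≡false w~s)
      fewer : new < old
      fewer = subst (_≤ old) (+-comm new 1) (subst (λ b → new + b2n b ≤ old) (Equivalence.to T-≡ ts-gap) drop)

  improve : Dense → ∀ {s r} → IsTour s r → 0 < gaps s r →
    ∃[ s′ ] ∃[ r′ ] (IsTour s′ r′ × gaps s′ r′ < gaps s r)
  improve dense τ some with gap-at-closing τ some
  ... | s , r , τ′ , same , closing-gap with split-at-step _ s r (crossing-step dense τ′)
  ...   | l₁ , w , l₂ , refl , crossing =
          let (s~w , t~u) = Equivalence.to T-∧ crossing
              t≡end = end-++ s l₁ (w ∷ l₂)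
              (τ″ , fewer) = reverse-segment s l₁ w l₂ τ′
                               (subst (λ v → T (gap (v , s))) t≡end closing-gap) s~w
                               (subst (λ v → T (adj v (end s l₁))) t≡end t~u)
          in s , _ , τ″ , subst (_ <_) same fewer

  gapless : Dense → ∀ {s r} → IsTour s r → Acc _<_ (gaps s r) →
    ∃[ s′ ] ∃[ r′ ] (IsTour s′ r′ × gaps s′ r′ ≡ 0)
  gapless dense {s} {r} τ (acc smaller) with gaps s r ≟ 0
  ... | yes none = s , r , τ , none
  ... | no some with improve dense τ (n≢0⇒n>0 some)
  ...   | _ , _ , τ′ , fewer = gapless dense τ′ (smaller fewer)

  zigzag : List (Fin a) → List V
  zigzag [] = []
  zigzag (x ∷ L) = inj₁ x ∷ inj₂ x ∷ zigzag L

  zigzag-↭ : ∀ L → zigzag L ↭ map inj₁ L ++ map inj₂ L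
  zigzag-↭ [] = ↭-refl
  zigzag-↭ (x ∷ L) = ↭-prep (inj₁ x)
    (↭-trans (↭-prep (inj₂ x) (zigzag-↭ L)) (↭-sym (shift (inj₂ x) (map inj₁ L) (map inj₂ L))))

  zigzag-alternating : ∀ x y L → cnt sameSide (steps (inj₂ y) (zigzag L ++ inj₁ x ∷ [])) ≡ 0
  zigzag-alternating x y [] = refl
  zigzag-alternating x y (z ∷ L) = zigzag-alternating x z L

  zigzag-tour : ∀ x L → allFin a ≡ x ∷ L → IsTour (inj₁ x) (inj₂ x ∷ zigzag L)
  zigzag-tour x L enumeration = record
    { spanning    = subst (λ F → zigzag (x ∷ L) ↭ map inj₁ F ++ map inj₂ F) (sym enumeration) (zigzag-↭ (x ∷ L))
    ; alternating = zigzag-alternating x x L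
    }

  hamiltonian : 0 < a → Dense → CyclicArrangement (λ u w → T (adj u w)) (2 * a)
  hamiltonian a>0 dense with allFin-nonempty a>0
  ... | x , L , enumeration with gapless dense (zigzag-tour x L enumeration) (<-wellFounded _)
  ...   | s , r , τ , no-gaps =
          let (inner , closing) = arc-none gap s r s no-gaps
          in ordering⇒arrangement adjacent s r (tour-length τ) (tour-unique τ)
               (none-fail adjacent (steps s r) inner) (not≡false closing)

underlying : ∀ {a} → BipDigraph a → Fin a → Fin a → Bool
underlying D x y = xy D x y ∨ yx D y x

cnt-+-≤-allFin : ∀ {a} (p q : Fin a → Bool) →
  cnt p (allFin a) + cnt q (allFin a) ≤ cnt (λ x → p x ∨ q x) (allFin a) + a
cnt-+-≤-allFin {a} p q =
  subst (λ n → cnt p (allFin a) + cnt q (allFin a) ≤ cnt (λ x → p x ∨ q x) (allFin a) + n) (length-tabulate (λ i → i)) (cnt-+-≤ p q (allFin a))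

degree-halving : ∀ {a d g} → 3 * a + 1 ≤ 2 * d → d ≤ g + a → a + 1 ≤ 2 * g
degree-halving {a} {d} {g} d-large d≤g+a = +-cancelʳ-≤ (2 * a) (a + 1) (2 * g) (begin
    a + 1 + 2 * a   ≡⟨ regroup a ⟩
    3 * a + 1       ≤⟨ d-large ⟩
    2 * d           ≤⟨ *-monoʳ-≤ 2 d≤g+a ⟩
    2 * (g + a)     ≡⟨ *-distribˡ-+ 2 g a ⟩
    2 * g + 2 * a   ∎)
  where
    open ≤-Reasoning
    regroup : ∀ a → a + 1 + 2 * a ≡ 3 * a + 1
    regroup = solve 1 (λ a → a :+ con 1 :+ con 2 :* a := con 3 :* a :+ con 1) refl
      where open +-*-Solver

-- Each neighbour of v in the underlying graph contributes one or two to d(v),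
-- and at most a of them two; so the underlying graph of D is dense.
underlying-dense : ∀ {a} (D : BipDigraph a) → MinDegCond D → Bipartite.Dense (underlying D)
underlying-dense {a} D min-degree (inj₁ x) =
  degree-halving (min-degree (inj₁ x))
    (subst (λ g → deg D (inj₁ x) ≤ g + a) (sym (degree-X x)) (cnt-+-≤-allFin (xy D x) (λ y → yx D y x)))
  where open Bipartite (underlying D)
underlying-dense {a} D min-degree (inj₂ y) =
  degree-halving (min-degree (inj₂ y))
    (subst₂ (λ d g → d ≤ g + a) (+-comm (indeg D (inj₂ y)) (outdeg D (inj₂ y))) (sym (degree-Y y))
      (cnt-+-≤-allFin (λ x → xy D x y) (λ x → yx D y x)))
  where open Bipartite (underlying D)

edge⇒arc : ∀ {a} (D : BipDigraph a) u w → T (Bipartite.adj (underlying D) u w) → Arc D u w ⊎ Arc D w u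
edge⇒arc D (inj₁ x) (inj₂ y) edge = Equivalence.to T-∨ edge
edge⇒arc D (inj₂ y) (inj₁ x) edge = swap (Equivalence.to T-∨ edge)

theorem1p9 : (a : ℕ) → 2 ≤ a → (D : BipDigraph a) → MinDegCond D →
    OrientedCycle D (2 * a)
theorem1p9 a 2≤a D min-degree =
  arrangement-map (edge⇒arc D)
    (Bipartite.hamiltonian (underlying D) (≤-trans (s≤s z≤n) 2≤a) (underlying-dense D min-degree))
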